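{- Let $\mathcal F$ be a Fano plane with set of lines $\mathcal F^\ast$. (i) Let $\alpha:\mathcal F\to\mathcal F^\ast$ be an oriented map and for $P\in\mathcal F$ let $\Delta_P=\mathcal F\setminus(\{P\}\cup\alpha(P))$. Then the set of seven triangles $\Delta_\alpha=\{\Delta_P:P\in\mathcal F\}$ satisfies the axioms of a Fano plane: (a) any two distinct points of $\mathcal F$ are contained in a unique element of $\Delta_\alpha$, and (b) any two distinct elements of $\Delta_\alpha$ intersect in a unique point. (ii) Conversely, if $\Delta$ is a set of seven triangles of $\mathcal F$ satisfying the axioms (a) and (b) of a Fano plane, then there exists a unique oriented map $\alpha:\mathcal F\to\mathcal F^\ast$ such that $\Delta=\Delta_\alpha$.
   Context: A Fano plane is a set $\mathcal F$ of seven points together with a set $\mathcal F^\ast$ of seven $3$-element subsets of $\mathcal F$ called lines, such that any two distinct points lie in a unique line and any two distinct lines meet in a unique point. A triangle is a $3$-element subset of $\mathcal F$ that is not a line. An oriented map is a map $\alpha:\mathcal F\to\mathcal F^\ast$ such that (i) $P\notin\alpha(P)$ for all $P\in\mathcal F$, and (ii) for all $P\ne Q$ in $\mathcal F$: $P\in\alpha(Q)$ if and only if $Q\notin\alpha(P)$. -}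

module Defs where

open import Data.Nat using (ℕ)
open import Data.Fin using (Fin)
open import Data.Fin.Subset using (Subset; _∈_; _∉_; ∣_∣; ⁅_⁆; _∪_; ∁)
open import Data.Product using (Σ; _×_; _,_)
open import Relation.Binary.PropositionalEquality using (_≡_; _≢_)

Point : Set
Point = Fin 7

Block : Set
Block = Subset 7

-- Axiom (a): any two distinct points lie in a unique element of the family
-- (uniqueness as subsets, i.e. as elements of the set {B i}).
AxiomA : (Fin 7 → Block) → Set
AxiomA B = (P Q : Point) → P ≢ Q →
  Σ (Fin 7) λ i → (P ∈ B i × Q ∈ B i) ×
    ((j : Fin 7) → P ∈ B j → Q ∈ B j → B j ≡ B i)

AxiomB : (Fin 7 → Block) → Set
AxiomB B = (i j : Fin 7) → B i ≢ B j →
  Σ Point λ P → (P ∈ B i × P ∈ B j) ×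
    ((R : Point) → R ∈ B i → R ∈ B j → R ≡ P)

Seven : (Fin 7 → Block) → Set
Seven B = (i j : Fin 7) → B i ≡ B j → i ≡ j

record FanoPlane : Set where
  field
    line       : Fin 7 → Block
    line-size  : (l : Fin 7) → ∣ line l ∣ ≡ 3
    line-seven : Seven line
    axiomA     : AxiomA line
    axiomB     : AxiomB line

module _ (F : FanoPlane) where
  open FanoPlane F

  Triangle : Block → Set
  Triangle T = ∣ T ∣ ≡ 3 × ((l : Fin 7) → T ≢ line l)

  Oriented : (Point → Fin 7) → Set
  Oriented α =
    ((P : Point) → P ∉ line (α P)) ×
    ((P Q : Point) → P ≢ Q →
      (P ∈ line (α Q) → Q ∉ line (α P)) × (Q ∉ line (α P) → P ∈ line (α Q)))

  Δ : (Point → Fin 7) → Point → Block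
  Δ α P = ∁ (⁅ P ⁆ ∪ line (α P))

  SameSet : (Fin 7 → Block) → (Fin 7 → Block) → Set
  SameSet B C = ((i : Fin 7) → Σ (Fin 7) λ j → B i ≡ C j) ×
                ((j : Fin 7) → Σ (Fin 7) λ i → C j ≡ B i)

{-# OPTIONS --safe #-}
-- (i) The two conditions on an oriented map say exactly that Q ∈ Δ_P iff P ∈ α(Q).
-- So X, Y ∈ Δ_P iff P is the meet of the lines α(X), α(Y), and Δ_P ∩ Δ_Q is the
-- point R with α(R) = PQ; α is injective, hence bijective, so Δ_α is the dual
-- plane transported along α.
-- (ii) A triangle t misses exactly one line m, and then t = F ∖ ({A} ∪ m) for the
-- one point A outside t ∪ m. Distinct blocks of Δ have distinct apexes A, so
-- α(A) := m is well defined. Since Δ_P and Δ_Q meet in a single point, its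
-- complement {P, Q} ∪ α(P) ∪ α(Q) has six points; as two distinct lines cover
-- five, exactly one of P ∈ α(Q), Q ∈ α(P) holds, i.e. α is oriented. It is
-- unique because F ∖ ({A} ∪ m) determines both A and m.

module Submission where

open import Data.Nat using (ℕ; suc; _+_; _∸_; _≤_; _<_; s≤s)
import Data.Nat.Properties as ℕ
open import Data.Fin using (Fin; zero; punchOut; _≟_)
open import Data.Fin.Properties using (any?; punchOut-injective; injective⇒≤)
open import Data.Fin.Subset
  using (Subset; inside; outside; _∈_; _∉_; _⊆_; ∣_∣; ⁅_⁆; _∪_; _∩_; ∁; ⊤)
  renaming (⊥ to ∅)
open import Data.Fin.Subset.Properties
open import Data.Empty using (⊥-elim)
open import Data.Product using (Σ; ∃; _×_; _,_; proj₁; proj₂)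
open import Data.Sum using (_⊎_; inj₁; inj₂; [_,_]′)
import Data.Sum as Sum
open import Data.Vec using ([]; _∷_)
open import Function using (_∘_; id)
open import Function.Definitions using (Injective)
open import Relation.Nullary using (yes; no; contradiction)
open import Relation.Nullary.Decidable using (_×-dec_; ¬?)
open import Relation.Binary.PropositionalEquality
  using (_≡_; _≢_; refl; sym; trans; cong; cong₂; subst; ≢-sym; module ≡-Reasoning)

open import Defs

private
  variable
    n : ℕ
    p q : Subset n
    x y a b c : Fin n

∣p∪q∣+∣p∩q∣≡∣p∣+∣q∣ : (p q : Subset n) → ∣ p ∪ q ∣ + ∣ p ∩ q ∣ ≡ ∣ p ∣ + ∣ q ∣
∣p∪q∣+∣p∩q∣≡∣p∣+∣q∣ []            []            = refl
∣p∪q∣+∣p∩q∣≡∣p∣+∣q∣ (inside ∷ p)  (inside ∷ q)  = cong suc (begin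
  ∣ p ∪ q ∣ + suc ∣ p ∩ q ∣  ≡⟨ ℕ.+-suc _ _ ⟩
  suc (∣ p ∪ q ∣ + ∣ p ∩ q ∣) ≡⟨ cong suc (∣p∪q∣+∣p∩q∣≡∣p∣+∣q∣ p q) ⟩
  suc (∣ p ∣ + ∣ q ∣)         ≡⟨ ℕ.+-suc _ _ ⟨
  ∣ p ∣ + suc ∣ q ∣           ∎)
  where open ≡-Reasoning
∣p∪q∣+∣p∩q∣≡∣p∣+∣q∣ (inside ∷ p)  (outside ∷ q) = cong suc (∣p∪q∣+∣p∩q∣≡∣p∣+∣q∣ p q)
∣p∪q∣+∣p∩q∣≡∣p∣+∣q∣ (outside ∷ p) (inside ∷ q)  =
  trans (cong suc (∣p∪q∣+∣p∩q∣≡∣p∣+∣q∣ p q)) (sym (ℕ.+-suc _ _))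
∣p∪q∣+∣p∩q∣≡∣p∣+∣q∣ (outside ∷ p) (outside ∷ q) = ∣p∪q∣+∣p∩q∣≡∣p∣+∣q∣ p q

∣p∪q∣≤∣p∣+∣q∣ : (p q : Subset n) → ∣ p ∪ q ∣ ≤ ∣ p ∣ + ∣ q ∣
∣p∪q∣≤∣p∣+∣q∣ p q = subst (∣ p ∪ q ∣ ≤_) (∣p∪q∣+∣p∩q∣≡∣p∣+∣q∣ p q) (ℕ.m≤m+n _ _)

disjoint⇒∣p∪q∣≡∣p∣+∣q∣ : (∀ {x} → x ∈ p → x ∉ q) → ∣ p ∪ q ∣ ≡ ∣ p ∣ + ∣ q ∣
disjoint⇒∣p∪q∣≡∣p∣+∣q∣ {n} {p} {q} p#q = begin
  ∣ p ∪ q ∣                ≡⟨ ℕ.+-identityʳ _ ⟨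
  ∣ p ∪ q ∣ + 0            ≡⟨ cong (∣ p ∪ q ∣ +_) (∣⊥∣≡0 n) ⟨
  ∣ p ∪ q ∣ + ∣ ∅ {n} ∣    ≡⟨ cong (λ s → ∣ p ∪ q ∣ + ∣ s ∣) p∩q≡∅ ⟨
  ∣ p ∪ q ∣ + ∣ p ∩ q ∣    ≡⟨ ∣p∪q∣+∣p∩q∣≡∣p∣+∣q∣ p q ⟩
  ∣ p ∣ + ∣ q ∣            ∎
  where
  open ≡-Reasoning
  p∩q≡∅ : p ∩ q ≡ ∅
  p∩q≡∅ = Empty-unique λ (x , x∈p∩q) → let x∈p , x∈q = x∈p∩q⁻ p q x∈p∩q in p#q x∈p x∈q

x∉p⇒∣⁅x⁆∪p∣≡1+∣p∣ : x ∉ p → ∣ ⁅ x ⁆ ∪ p ∣ ≡ suc ∣ p ∣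
x∉p⇒∣⁅x⁆∪p∣≡1+∣p∣ {x = x} {p = p} x∉p =
  trans (disjoint⇒∣p∪q∣≡∣p∣+∣q∣ λ y∈⁅x⁆ → x∉p ∘ subst (_∈ p) (x∈⁅y⁆⇒x≡y x y∈⁅x⁆))
        (cong (_+ ∣ p ∣) (∣⁅x⁆∣≡1 x))

x∉p∪q⁺ : x ∉ p → x ∉ q → x ∉ p ∪ q
x∉p∪q⁺ x∉p x∉q = [ x∉p , x∉q ]′ ∘ x∈p∪q⁻ _ _

x∈p⇒⁅x⁆∪p≡p : x ∈ p → ⁅ x ⁆ ∪ p ≡ p
x∈p⇒⁅x⁆∪p≡p {x = x} {p = p} x∈p = ⊆-antisym ⁅x⁆∪p⊆p (q⊆p∪q ⁅ x ⁆ p)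
  where
  ⁅x⁆∪p⊆p : ⁅ x ⁆ ∪ p ⊆ p
  ⁅x⁆∪p⊆p y∈ = [ (λ y∈⁅x⁆ → subst (_∈ p) (sym (x∈⁅y⁆⇒x≡y x y∈⁅x⁆)) x∈p) , id ]′ (x∈p∪q⁻ _ _ y∈)

∣⁅x⁆∪p∣≤1+∣p∣ : (x : Fin n) (p : Subset n) → ∣ ⁅ x ⁆ ∪ p ∣ ≤ suc ∣ p ∣
∣⁅x⁆∪p∣≤1+∣p∣ x p = subst (λ k → ∣ ⁅ x ⁆ ∪ p ∣ ≤ k + ∣ p ∣) (∣⁅x⁆∣≡1 x) (∣p∪q∣≤∣p∣+∣q∣ ⁅ x ⁆ p)

unique-outside⇒1+∣p∣≡n : ∀ {n} {x : Fin n} {p} → x ∉ p → (∀ y → y ∉ p → y ≡ x) → suc ∣ p ∣ ≡ n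
unique-outside⇒1+∣p∣≡n {n} {x} {p} x∉p unique = begin
  suc ∣ p ∣        ≡⟨ x∉p⇒∣⁅x⁆∪p∣≡1+∣p∣ x∉p ⟨
  ∣ ⁅ x ⁆ ∪ p ∣    ≡⟨ cong ∣_∣ (⊆-antisym (λ _ → ∈⊤) ⊤⊆⁅x⁆∪p) ⟩
  ∣ ⊤ {n} ∣        ≡⟨ ∣⊤∣≡n n ⟩
  n                ∎
  where
  open ≡-Reasoning
  ⊤⊆⁅x⁆∪p : ⊤ ⊆ ⁅ x ⁆ ∪ p
  ⊤⊆⁅x⁆∪p {y} _ with y ∈? p
  ... | yes y∈p = x∈p∪q⁺ (inj₂ y∈p)
  ... | no  y∉p = x∈p∪q⁺ (inj₁ (subst (_∈ ⁅ x ⁆) (sym (unique y y∉p)) (x∈⁅x⁆ x)))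

-- The opaque blocks stop the type checker from unfolding these existence proofs
-- (an exhaustive search, resp. a long construction), which it otherwise does when
-- checking the with-abstractions over their results, at prohibitive cost.
opaque
  ⊆-or-∈∖ : (p q : Subset n) → p ⊆ q ⊎ ∃ λ x → x ∈ p × x ∉ q
  ⊆-or-∈∖ p q with any? (λ x → x ∈? p ×-dec ¬? (x ∈? q))
  ... | yes witness = inj₂ witness
  ... | no  ∄       = inj₁ p⊆q
    where
    p⊆q : p ⊆ q
    p⊆q {x} x∈p with x ∈? q
    ... | yes x∈q = x∈q
    ... | no  x∉q = contradiction (x , x∈p , x∉q) ∄

∣p∣<∣q∣⇒∃∈q∖p : ∣ p ∣ < ∣ q ∣ → ∃ λ x → x ∈ q × x ∉ p
∣p∣<∣q∣⇒∃∈q∖p {p = p} {q = q} ∣p∣<∣q∣ with ⊆-or-∈∖ q p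
... | inj₂ witness = witness
... | inj₁ q⊆p     = contradiction (p⊆q⇒∣p∣≤∣q∣ q⊆p) (ℕ.<⇒≱ ∣p∣<∣q∣)

∣p∣<n⇒∃∉p : ∀ {n} {p : Subset n} → ∣ p ∣ < n → ∃ λ x → x ∉ p
∣p∣<n⇒∃∉p {n} {p} ∣p∣<n with ∣p∣<∣q∣⇒∃∈q∖p {q = ⊤} (subst (∣ p ∣ <_) (sym (∣⊤∣≡n n)) ∣p∣<n)
... | x , _ , x∉p = x , x∉p

p⊆q∧∣p∣≡∣q∣⇒p≡q : p ⊆ q → ∣ p ∣ ≡ ∣ q ∣ → p ≡ q
p⊆q∧∣p∣≡∣q∣⇒p≡q {p = p} {q = q} p⊆q ∣p∣≡∣q∣ with ⊆-or-∈∖ q p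
... | inj₁ q⊆p             = ⊆-antisym p⊆q q⊆p
... | inj₂ (x , x∈q , x∉p) =
  contradiction ∣p∣≡∣q∣ (ℕ.<⇒≢ (p⊂q⇒∣p∣<∣q∣ (p⊆q , x , x∈q , x∉p)))

∣p∣≡3⇒∃-third : ∣ p ∣ ≡ 3 → (a b : Fin n) → ∃ λ x → x ∈ p × x ≢ a × x ≢ b
∣p∣≡3⇒∃-third {p = p} ∣p∣≡3 a b with ∣p∣<∣q∣⇒∃∈q∖p {p = ⁅ a ⁆ ∪ ⁅ b ⁆} {q = p} ∣⁅a⁆∪⁅b⁆∣<3
  where
  ∣⁅a⁆∪⁅b⁆∣<3 : ∣ ⁅ a ⁆ ∪ ⁅ b ⁆ ∣ < ∣ p ∣
  ∣⁅a⁆∪⁅b⁆∣<3 = subst (∣ ⁅ a ⁆ ∪ ⁅ b ⁆ ∣ <_) (sym ∣p∣≡3)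
    (s≤s (subst (λ k → ∣ ⁅ a ⁆ ∪ ⁅ b ⁆ ∣ ≤ suc k) (∣⁅x⁆∣≡1 b) (∣⁅x⁆∪p∣≤1+∣p∣ a ⁅ b ⁆)))
... | x , x∈p , x∉⁅a⁆∪⁅b⁆ =
  x , x∈p , x∉⁅a⁆∪⁅b⁆ ∘ x∈p∪q⁺ ∘ inj₁ ∘ x≡y⇒x∈⁅y⁆ , x∉⁅a⁆∪⁅b⁆ ∘ x∈p∪q⁺ ∘ inj₂ ∘ x≡y⇒x∈⁅y⁆
  where
  x≡y⇒x∈⁅y⁆ : ∀ {y} → x ≡ y → x ∈ ⁅ y ⁆
  x≡y⇒x∈⁅y⁆ refl = x∈⁅x⁆ x

∣p∣≡3∧x∈p⇒x≡a⊎x≡b⊎x≡c : ∣ p ∣ ≡ 3 → a ∈ p → b ∈ p → c ∈ p → a ≢ b → a ≢ c → b ≢ c →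
                          x ∈ p → x ≡ a ⊎ x ≡ b ⊎ x ≡ c
∣p∣≡3∧x∈p⇒x≡a⊎x≡b⊎x≡c {p = p} {a = a} {b = b} {c = c} ∣p∣≡3 a∈p b∈p c∈p a≢b a≢c b≢c x∈p =
  elements (subst (_ ∈_) (sym abc≡p) x∈p)
  where
  abc : Subset _
  abc = ⁅ a ⁆ ∪ (⁅ b ⁆ ∪ ⁅ c ⁆)
  elements : ∀ {x} → x ∈ abc → x ≡ a ⊎ x ≡ b ⊎ x ≡ c
  elements = Sum.map (x∈⁅y⁆⇒x≡y a) (Sum.map (x∈⁅y⁆⇒x≡y b) (x∈⁅y⁆⇒x≡y c) ∘ x∈p∪q⁻ _ _)
           ∘ x∈p∪q⁻ _ _
  ≡∈p : ∀ {x y} → y ∈ p → x ≡ y → x ∈ p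
  ≡∈p y∈p refl = y∈p
  abc⊆p : abc ⊆ p
  abc⊆p = [ ≡∈p a∈p , [ ≡∈p b∈p , ≡∈p c∈p ]′ ]′ ∘ elements
  ∣abc∣≡3 : ∣ abc ∣ ≡ 3
  ∣abc∣≡3 = trans (x∉p⇒∣⁅x⁆∪p∣≡1+∣p∣ ([ x≢y⇒x∉⁅y⁆ a≢b , x≢y⇒x∉⁅y⁆ a≢c ]′ ∘ x∈p∪q⁻ _ _))
           (cong suc (trans (x∉p⇒∣⁅x⁆∪p∣≡1+∣p∣ (x≢y⇒x∉⁅y⁆ b≢c)) (cong suc (∣⁅x⁆∣≡1 c))))
  abc≡p : abc ≡ p
  abc≡p = p⊆q∧∣p∣≡∣q∣⇒p≡q abc⊆p (trans ∣abc∣≡3 (sym ∣p∣≡3))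

injective⇒surjective : ∀ {n} {f : Fin n → Fin n} → Injective _≡_ _≡_ f → ∀ y → ∃ λ x → f x ≡ y
injective⇒surjective {suc _} {f} f-injective y with any? (λ x → f x ≟ y)
... | yes found = found
... | no  ∄     = contradiction (injective⇒≤ punchOut-y∘f-injective) ℕ.1+n≰n
  where
  y≢f : ∀ x → y ≢ f x
  y≢f x y≡fx = ∄ (x , sym y≡fx)
  punchOut-y∘f-injective : Injective _≡_ _≡_ (λ x → punchOut (y≢f x))
  punchOut-y∘f-injective eq = f-injective (punchOut-injective (y≢f _) (y≢f _) eq)

Δ[_,_] : Fin n → Subset n → Subset n
Δ[ x , p ] = ∁ (⁅ x ⁆ ∪ p)

∈Δ[]⁺ : y ≢ x → y ∉ p → y ∈ Δ[ x , p ]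
∈Δ[]⁺ y≢x y∉p = x∉p⇒x∈∁p ([ y≢x ∘ x∈⁅y⁆⇒x≡y _ , y∉p ]′ ∘ x∈p∪q⁻ _ _)

∈Δ[]⇒≢ : y ∈ Δ[ x , p ] → y ≢ x
∈Δ[]⇒≢ y∈Δ refl = x∈∁p⇒x∉p y∈Δ (x∈p∪q⁺ (inj₁ (x∈⁅x⁆ _)))

∈Δ[]⇒∉ : y ∈ Δ[ x , p ] → y ∉ p
∈Δ[]⇒∉ y∈Δ y∈p = x∈∁p⇒x∉p y∈Δ (x∈p∪q⁺ (inj₂ y∈p))

∉Δ[]⇒∈ : y ∉ Δ[ x , p ] → y ≢ x → y ∈ p
∉Δ[]⇒∈ {y = y} {p = p} y∉Δ y≢x with y ∈? p
... | yes y∈p = y∈p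
... | no  y∉p = contradiction (∈Δ[]⁺ y≢x y∉p) y∉Δ

∣Δ[x,p]∣≡n∸1+∣p∣ : ∀ {n} {x : Fin n} {p} → x ∉ p → ∣ Δ[ x , p ] ∣ ≡ n ∸ suc ∣ p ∣
∣Δ[x,p]∣≡n∸1+∣p∣ {n} {x} {p} x∉p =
  trans (∣∁p∣≡n∸∣p∣ (⁅ x ⁆ ∪ p)) (cong (n ∸_) (x∉p⇒∣⁅x⁆∪p∣≡1+∣p∣ x∉p))

module _ {B : Fin 7 → Block} where

  AxiomA⇒joining-unique : AxiomA B → ∀ {P Q i j} → P ≢ Q →
                          P ∈ B i → Q ∈ B i → P ∈ B j → Q ∈ B j → B i ≡ B j
  AxiomA⇒joining-unique axiomA P≢Q P∈i Q∈i P∈j Q∈j with axiomA _ _ P≢Q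
  ... | _ , _ , unique = trans (unique _ P∈i Q∈i) (sym (unique _ P∈j Q∈j))

  AxiomB⇒meet-unique : AxiomB B → ∀ {i j x y} → B i ≢ B j →
                       x ∈ B i → x ∈ B j → y ∈ B i → y ∈ B j → x ≡ y
  AxiomB⇒meet-unique axiomB i≢j x∈i x∈j y∈i y∈j with axiomB _ _ i≢j
  ... | _ , _ , unique = trans (unique _ x∈i x∈j) (sym (unique _ y∈i y∈j))

module FanoGeometry (F : FanoPlane) where

  open FanoPlane F

  private
    variable
      P Q R : Point
      i j l m : Fin 7
      t : Block

  line-through : P ≢ Q → Fin 7
  line-through P≢Q = proj₁ (axiomA _ _ P≢Q)

  ∈line-throughˡ : (P≢Q : P ≢ Q) → P ∈ line (line-through P≢Q)
  ∈line-throughˡ P≢Q = proj₁ (proj₁ (proj₂ (axiomA _ _ P≢Q)))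

  ∈line-throughʳ : (P≢Q : P ≢ Q) → Q ∈ line (line-through P≢Q)
  ∈line-throughʳ P≢Q = proj₂ (proj₁ (proj₂ (axiomA _ _ P≢Q)))

  line-unique : P ≢ Q → P ∈ line i → Q ∈ line i → P ∈ line j → Q ∈ line j → i ≡ j
  line-unique P≢Q P∈i Q∈i P∈j Q∈j =
    line-seven _ _ (AxiomA⇒joining-unique axiomA P≢Q P∈i Q∈i P∈j Q∈j)

  lines-meet-unique : i ≢ j → P ∈ line i → P ∈ line j → Q ∈ line i → Q ∈ line j → P ≡ Q
  lines-meet-unique i≢j = AxiomB⇒meet-unique axiomB (i≢j ∘ line-seven _ _)

  lines-meet : ∀ i j → ∃ λ P → P ∈ line i × P ∈ line j
  lines-meet i j with i ≟ j
  ... | yes refl with ∣p∣≡3⇒∃-third (line-size i) zero zero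
  ...   | P , P∈i , _ = P , P∈i , P∈i
  lines-meet i j | no i≢j with axiomB i j (i≢j ∘ line-seven i j)
  ...   | P , P∈i∩j , _ = P , P∈i∩j

  ∣line∪line∣≡5 : i ≢ j → ∣ line i ∪ line j ∣ ≡ 5
  ∣line∪line∣≡5 {i} {j} i≢j with lines-meet i j
  ... | P , P∈i , P∈j = ℕ.+-cancelʳ-≡ 1 _ _ (begin
    ∣ line i ∪ line j ∣ + 1                      ≡⟨ cong (_ +_) (∣⁅x⁆∣≡1 P) ⟨
    ∣ line i ∪ line j ∣ + ∣ ⁅ P ⁆ ∣              ≡⟨ cong (λ s → _ + ∣ s ∣) i∩j≡⁅P⁆ ⟨
    ∣ line i ∪ line j ∣ + ∣ line i ∩ line j ∣    ≡⟨ ∣p∪q∣+∣p∩q∣≡∣p∣+∣q∣ (line i) (line j) ⟩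
    ∣ line i ∣ + ∣ line j ∣                      ≡⟨ cong₂ _+_ (line-size i) (line-size j) ⟩
    5 + 1                                        ∎)
    where
    open ≡-Reasoning
    i∩j≡⁅P⁆ : line i ∩ line j ≡ ⁅ P ⁆
    i∩j≡⁅P⁆ = ⊆-antisym
      (λ x∈i∩j → let x∈i , x∈j = x∈p∩q⁻ _ _ x∈i∩j in
        subst (_∈ ⁅ P ⁆) (sym (lines-meet-unique i≢j x∈i x∈j P∈i P∈j)) (x∈⁅x⁆ P))
      (λ x∈⁅P⁆ → subst (_∈ line i ∩ line j) (sym (x∈⁅y⁆⇒x≡y P x∈⁅P⁆)) (x∈p∩q⁺ (P∈i , P∈j)))

  line-avoiding-two-contains-third : P ∈ line l → Q ∈ line l → R ∈ line l →
    P ≢ Q → P ≢ R → Q ≢ R → P ∉ line m → Q ∉ line m → R ∈ line m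
  line-avoiding-two-contains-third {l = l} {m = m} P∈l Q∈l R∈l P≢Q P≢R Q≢R P∉m Q∉m
    with lines-meet l m
  ... | S , S∈l , S∈m with ∣p∣≡3∧x∈p⇒x≡a⊎x≡b⊎x≡c (line-size l) P∈l Q∈l R∈l P≢Q P≢R Q≢R S∈l
  ...   | inj₁ refl        = contradiction S∈m P∉m
  ...   | inj₂ (inj₁ refl) = contradiction S∈m Q∉m
  ...   | inj₂ (inj₂ refl) = S∈m

  noncollinear⇒avoiding-line : P ≢ Q → P ≢ R → Q ≢ R →
    (∀ l → P ∈ line l → Q ∈ line l → R ∉ line l) →
    ∃ λ m → P ∉ line m × Q ∉ line m × R ∉ line m
  noncollinear⇒avoiding-line {P} {Q} {R} P≢Q P≢R Q≢R noncollinear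
    with ∣p∣≡3⇒∃-third (line-size (line-through P≢Q)) P Q
       | ∣p∣≡3⇒∃-third (line-size (line-through P≢R)) P R
  ... | X , X∈PQ , X≢P , X≢Q | Y , Y∈PR , Y≢P , Y≢R = XY , P∉XY , Q∉XY , R∉XY
    where
    PQ PR XY : Fin 7
    PQ = line-through P≢Q
    PR = line-through P≢R
    PQ≢PR : PQ ≢ PR
    PQ≢PR PQ≡PR = noncollinear PQ (∈line-throughˡ P≢Q) (∈line-throughʳ P≢Q)
                    (subst (λ k → R ∈ line k) (sym PQ≡PR) (∈line-throughʳ P≢R))
    only-P : ∀ {S} → S ∈ line PQ → S ∈ line PR → S ≡ P
    only-P S∈PQ S∈PR = lines-meet-unique PQ≢PR S∈PQ S∈PR (∈line-throughˡ P≢Q) (∈line-throughˡ P≢R)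
    X≢Y : X ≢ Y
    X≢Y refl = X≢P (only-P X∈PQ Y∈PR)
    XY = line-through X≢Y
    X∈XY = ∈line-throughˡ X≢Y
    Y∈XY = ∈line-throughʳ X≢Y
    P∉XY : P ∉ line XY
    P∉XY P∈XY = Y≢P (only-P (subst (λ k → Y ∈ line k)
      (line-unique (≢-sym X≢P) P∈XY X∈XY (∈line-throughˡ P≢Q) X∈PQ) Y∈XY) Y∈PR)
    Q∉XY : Q ∉ line XY
    Q∉XY Q∈XY = Y≢P (only-P (subst (λ k → Y ∈ line k)
      (line-unique (≢-sym X≢Q) Q∈XY X∈XY (∈line-throughʳ P≢Q) X∈PQ) Y∈XY) Y∈PR)
    R∉XY : R ∉ line XY
    R∉XY R∈XY = X≢P (only-P X∈PQ (subst (λ k → X ∈ line k)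
      (line-unique (≢-sym Y≢R) R∈XY Y∈XY (∈line-throughʳ P≢R) Y∈PR) X∈XY))

  triangle-noncollinear : Triangle F t → P ∈ t → Q ∈ t → R ∈ t → P ≢ Q → P ≢ R → Q ≢ R →
                          P ∈ line l → Q ∈ line l → R ∉ line l
  triangle-noncollinear {t} {l = l} (∣t∣≡3 , not-line) P∈t Q∈t R∈t P≢Q P≢R Q≢R P∈l Q∈l R∈l =
    not-line l (p⊆q∧∣p∣≡∣q∣⇒p≡q t⊆l (trans ∣t∣≡3 (sym (line-size l))))
    where
    t⊆l : t ⊆ line l
    t⊆l = [ (λ { refl → P∈l }) , [ (λ { refl → Q∈l }) , (λ { refl → R∈l }) ]′ ]′
        ∘ ∣p∣≡3∧x∈p⇒x≡a⊎x≡b⊎x≡c ∣t∣≡3 P∈t Q∈t R∈t P≢Q P≢R Q≢R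

  record ApexForm (t : Block) : Set where
    field
      apex           : Point
      base           : Fin 7
      apex∉base      : apex ∉ line base
      t≡Δ[apex,base] : t ≡ Δ[ apex , line base ]

  disjoint-from-line⇒apexForm : ∣ t ∣ ≡ 3 → (∀ {x} → x ∈ t → x ∉ line m) → ApexForm t
  disjoint-from-line⇒apexForm {t} {m} ∣t∣≡3 t#m = apexForm (∣p∣<n⇒∃∉p ∣t∪m∣<7)
    where
    ∣t∪m∣<7 : ∣ t ∪ line m ∣ < 7
    ∣t∪m∣<7 = ℕ.≤-reflexive
      (cong suc (trans (disjoint⇒∣p∪q∣≡∣p∣+∣q∣ t#m) (cong₂ _+_ ∣t∣≡3 (line-size m))))
    apexForm : (∃ λ A → A ∉ t ∪ line m) → ApexForm t
    apexForm (A , A∉t∪m) = record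
      { apex           = A
      ; base           = m
      ; apex∉base      = A∉m
      ; t≡Δ[apex,base] = p⊆q∧∣p∣≡∣q∣⇒p≡q t⊆Δ (trans ∣t∣≡3 (sym ∣Δ∣≡3))
      }
      where
      A∉m : A ∉ line m
      A∉m = A∉t∪m ∘ x∈p∪q⁺ ∘ inj₂
      t⊆Δ : t ⊆ Δ[ A , line m ]
      t⊆Δ x∈t = ∈Δ[]⁺ (λ { refl → A∉t∪m (x∈p∪q⁺ (inj₁ x∈t)) }) (t#m x∈t)
      ∣Δ∣≡3 : ∣ Δ[ A , line m ] ∣ ≡ 3
      ∣Δ∣≡3 = trans (∣Δ[x,p]∣≡n∸1+∣p∣ A∉m) (cong (λ k → 7 ∸ suc k) (line-size m))

  opaque
    -- The avoided line is the one through the third points of two sides at P.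
    triangle⇒apexForm : Triangle F t → ApexForm t
    triangle⇒apexForm {t} triangle@(∣t∣≡3 , _)
      with ∣p∣≡3⇒∃-third ∣t∣≡3 zero zero
    ... | P , P∈t , _ with ∣p∣≡3⇒∃-third ∣t∣≡3 P P
    ... | Q , Q∈t , Q≢P , _ with ∣p∣≡3⇒∃-third ∣t∣≡3 P Q
    ... | R , R∈t , R≢P , R≢Q
      with noncollinear⇒avoiding-line (≢-sym Q≢P) (≢-sym R≢P) (≢-sym R≢Q)
             (λ l → triangle-noncollinear triangle P∈t Q∈t R∈t (≢-sym Q≢P) (≢-sym R≢P) (≢-sym R≢Q))
    ... | m , P∉m , Q∉m , R∉m = disjoint-from-line⇒apexForm ∣t∣≡3 t#m
      where
      t#m : ∀ {x} → x ∈ t → x ∉ line m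
      t#m = [ (λ { refl → P∉m }) , [ (λ { refl → Q∉m }) , (λ { refl → R∉m }) ]′ ]′
          ∘ ∣p∣≡3∧x∈p⇒x≡a⊎x≡b⊎x≡c ∣t∣≡3 P∈t Q∈t R∈t (≢-sym Q≢P) (≢-sym R≢P) (≢-sym R≢Q)

  Δ[]-injective : P ∉ line i → Q ∉ line j → Δ[ P , line i ] ≡ Δ[ Q , line j ] → P ≡ Q × i ≡ j
  Δ[]-injective {P} {i} {Q} {j} P∉i Q∉j Δ≡Δ = P≡Q , i≡j
    where
    i∖Q⊆j : ∀ {x} → x ∈ line i → x ≢ Q → x ∈ line j
    i∖Q⊆j x∈i = ∉Δ[]⇒∈ (λ x∈Δ → ∈Δ[]⇒∉ (subst (_ ∈_) (sym Δ≡Δ) x∈Δ) x∈i)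
    i≡j : i ≡ j
    i≡j with ∣p∣≡3⇒∃-third (line-size i) Q Q
    ... | X , X∈i , X≢Q , _ with ∣p∣≡3⇒∃-third (line-size i) Q X
    ...   | Y , Y∈i , Y≢Q , Y≢X =
      line-unique (≢-sym Y≢X) X∈i Y∈i (i∖Q⊆j X∈i X≢Q) (i∖Q⊆j Y∈i Y≢Q)
    P≡Q : P ≡ Q
    P≡Q with P ≟ Q
    ... | yes P≡Q = P≡Q
    ... | no  P≢Q = contradiction (subst (λ k → P ∈ line k) (sym i≡j) (∉Δ[]⇒∈ P∉Δ[Q,j] P≢Q)) P∉i
      where
      P∉Δ[Q,j] : P ∉ Δ[ Q , line j ]
      P∉Δ[Q,j] P∈Δ = ∈Δ[]⇒≢ (subst (P ∈_) (sym Δ≡Δ) P∈Δ) refl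

  Δ[]-triangle : P ∉ line m → Triangle F Δ[ P , line m ]
  Δ[]-triangle {P} {m} P∉m =
    trans (∣Δ[x,p]∣≡n∸1+∣p∣ P∉m) (cong (λ k → 7 ∸ suc k) (line-size m)) , not-line
    where
    not-line : ∀ l → Δ[ P , line m ] ≢ line l
    not-line l Δ≡l with lines-meet l m
    ... | x , x∈l , x∈m = ∈Δ[]⇒∉ (subst (x ∈_) (sym Δ≡l) x∈l) x∈m

  single-meet⇒exactly-one-incidence :
    P ≢ Q → P ∉ line i → Q ∉ line j → R ∈ Δ[ P , line i ] → R ∈ Δ[ Q , line j ] →
    (∀ S → S ∈ Δ[ P , line i ] → S ∈ Δ[ Q , line j ] → S ≡ R) →
    (P ∈ line j → Q ∉ line i) × (Q ∉ line i → P ∈ line j)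
  single-meet⇒exactly-one-incidence {P} {Q} {i} {j} {R} P≢Q P∉i Q∉j R∈ΔP R∈ΔQ single =
    at-most-one , at-least-one
    where
    -- N is the complement of Δ[ P , line i ] ∩ Δ[ Q , line j ].
    U N : Block
    U = line i ∪ line j
    N = ⁅ P ⁆ ∪ (⁅ Q ⁆ ∪ U)
    ∉N⇒∈Δ∩Δ : ∀ {S} → S ∉ N → S ∈ Δ[ P , line i ] × S ∈ Δ[ Q , line j ]
    ∉N⇒∈Δ∩Δ S∉N =
        ∈Δ[]⁺ (S∉N ∘ x∈p∪q⁺ ∘ inj₁ ∘ λ { refl → x∈⁅x⁆ P }) (S∉N ∘ ∈N ∘ x∈p∪q⁺ ∘ inj₁)
      , ∈Δ[]⁺ (S∉N ∘ x∈p∪q⁺ ∘ inj₂ ∘ x∈p∪q⁺ ∘ inj₁ ∘ λ { refl → x∈⁅x⁆ Q }) (S∉N ∘ ∈N ∘ x∈p∪q⁺ ∘ inj₂)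
      where
      ∈N : ∀ {S} → S ∈ U → S ∈ N
      ∈N = x∈p∪q⁺ ∘ inj₂ ∘ x∈p∪q⁺ ∘ inj₂
    R∉N : R ∉ N
    R∉N = x∉p∪q⁺ (x≢y⇒x∉⁅y⁆ (∈Δ[]⇒≢ R∈ΔP))
         (x∉p∪q⁺ (x≢y⇒x∉⁅y⁆ (∈Δ[]⇒≢ R∈ΔQ)) (x∉p∪q⁺ (∈Δ[]⇒∉ R∈ΔP) (∈Δ[]⇒∉ R∈ΔQ)))
    1+∣N∣≡7 : suc ∣ N ∣ ≡ 7
    1+∣N∣≡7 = unique-outside⇒1+∣p∣≡n R∉N λ S S∉N → let S∈ΔP , S∈ΔQ = ∉N⇒∈Δ∩Δ S∉N in single S S∈ΔP S∈ΔQ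
    i≢j : i ≢ j
    i≢j refl = ℕ.1+n≰n (begin
      7                       ≡⟨ 1+∣N∣≡7 ⟨
      suc ∣ N ∣               ≤⟨ s≤s (∣⁅x⁆∪p∣≤1+∣p∣ P _) ⟩
      suc (suc ∣ ⁅ Q ⁆ ∪ U ∣) ≤⟨ s≤s (s≤s (∣⁅x⁆∪p∣≤1+∣p∣ Q U)) ⟩
      3 + ∣ line i ∪ line i ∣  ≡⟨ cong (λ s → 3 + ∣ s ∣) (∪-idem (line i)) ⟩
      3 + ∣ line i ∣           ≡⟨ cong (3 +_) (line-size i) ⟩
      6                       ∎)
      where open ℕ.≤-Reasoning
    ∣U∣≡5 : ∣ U ∣ ≡ 5
    ∣U∣≡5 = ∣line∪line∣≡5 i≢j
    at-most-one : P ∈ line j → Q ∉ line i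
    at-most-one P∈j Q∈i = ℕ.1+n≰n (ℕ.≤-reflexive (begin
      7                   ≡⟨ 1+∣N∣≡7 ⟨
      suc ∣ N ∣           ≡⟨ cong (suc ∘ ∣_∣) (trans (cong (⁅ P ⁆ ∪_) ⁅Q⁆∪U≡U) (x∈p⇒⁅x⁆∪p≡p (x∈p∪q⁺ (inj₂ P∈j)))) ⟩
      suc ∣ U ∣           ≡⟨ cong suc ∣U∣≡5 ⟩
      6                   ∎))
      where
      open ≡-Reasoning
      ⁅Q⁆∪U≡U : ⁅ Q ⁆ ∪ U ≡ U
      ⁅Q⁆∪U≡U = x∈p⇒⁅x⁆∪p≡p (x∈p∪q⁺ (inj₁ Q∈i))
    at-least-one : Q ∉ line i → P ∈ line j
    at-least-one Q∉i with P ∈? line j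
    ... | yes P∈j = P∈j
    ... | no  P∉j = contradiction (begin
      8                   ≡⟨ cong (suc ∘ suc ∘ suc) ∣U∣≡5 ⟨
      suc (suc (suc ∣ U ∣)) ≡⟨ cong (suc ∘ suc) (x∉p⇒∣⁅x⁆∪p∣≡1+∣p∣ (x∉p∪q⁺ Q∉i Q∉j)) ⟨
      suc (suc ∣ ⁅ Q ⁆ ∪ U ∣) ≡⟨ cong suc (x∉p⇒∣⁅x⁆∪p∣≡1+∣p∣ P∉⁅Q⁆∪U) ⟨
      suc ∣ N ∣           ≡⟨ 1+∣N∣≡7 ⟩
      7                   ∎) λ ()
      where
      open ≡-Reasoning
      P∉⁅Q⁆∪U : P ∉ ⁅ Q ⁆ ∪ U
      P∉⁅Q⁆∪U = x∉p∪q⁺ (x≢y⇒x∉⁅y⁆ P≢Q) (x∉p∪q⁺ P∉i P∉j)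

  module OrientedMap (α : Point → Fin 7) (oriented : Oriented F α) where

    α-irreflexive : ∀ P → P ∉ line (α P)
    α-irreflexive = proj₁ oriented

    α-exactly-one : ∀ P Q → P ≢ Q →
                    (P ∈ line (α Q) → Q ∉ line (α P)) × (Q ∉ line (α P) → P ∈ line (α Q))
    α-exactly-one = proj₂ oriented

    ∈Δ⇒∈α : Q ∈ Δ F α P → P ∈ line (α Q)
    ∈Δ⇒∈α {Q} {P} Q∈Δ = proj₂ (α-exactly-one P Q (≢-sym (∈Δ[]⇒≢ Q∈Δ))) (∈Δ[]⇒∉ Q∈Δ)

    ∈α⇒∈Δ : P ∈ line (α Q) → Q ∈ Δ F α P
    ∈α⇒∈Δ {P} {Q} P∈αQ = ∈Δ[]⁺ (≢-sym P≢Q) (proj₁ (α-exactly-one P Q P≢Q) P∈αQ)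
      where
      P≢Q : P ≢ Q
      P≢Q refl = α-irreflexive P P∈αQ

    α-injective : Injective _≡_ _≡_ α
    α-injective {P} {Q} αP≡αQ with P ≟ Q
    ... | yes P≡Q = P≡Q
    ... | no  P≢Q with Q ∈? line (α P)
    ...   | yes Q∈αP = contradiction (subst (λ k → Q ∈ line k) αP≡αQ Q∈αP) (α-irreflexive Q)
    ...   | no  Q∉αP = contradiction (subst (λ k → P ∈ line k) (sym αP≡αQ) (proj₂ (α-exactly-one P Q P≢Q) Q∉αP))
                                     (α-irreflexive P)

    Δ-triangle : ∀ P → Triangle F (Δ F α P)
    Δ-triangle P = Δ[]-triangle (α-irreflexive P)

    Δ-seven : Seven (Δ F α)
    Δ-seven P Q ΔP≡ΔQ with P ≟ Q
    ... | yes P≡Q = P≡Q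
    ... | no  P≢Q = ⊥-elim (∈Δ[]⇒≢ (subst (Q ∈_) ΔP≡ΔQ (∈α⇒∈Δ (proj₂ (α-exactly-one P Q P≢Q) Q∉αP))) refl)
      where
      Q∉αP : Q ∉ line (α P)
      Q∉αP Q∈αP = ∈Δ[]⇒≢ (subst (P ∈_) (sym ΔP≡ΔQ) (∈α⇒∈Δ Q∈αP)) refl

    Δ-axiomA : AxiomA (Δ F α)
    Δ-axiomA X Y X≢Y with axiomB (α X) (α Y) (X≢Y ∘ α-injective ∘ line-seven _ _)
    ... | P , (P∈αX , P∈αY) , unique =
      P , (∈α⇒∈Δ P∈αX , ∈α⇒∈Δ P∈αY) , λ j X∈Δj Y∈Δj → cong (Δ F α) (unique j (∈Δ⇒∈α X∈Δj) (∈Δ⇒∈α Y∈Δj))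

    Δ-axiomB : AxiomB (Δ F α)
    Δ-axiomB P Q ΔP≢ΔQ with axiomA P Q (ΔP≢ΔQ ∘ cong (Δ F α))
    ... | k , (P∈k , Q∈k) , unique with injective⇒surjective α-injective k
    ...   | R , αR≡k = R , (∈α⇒∈Δ P∈αR , ∈α⇒∈Δ Q∈αR) , λ S S∈ΔP S∈ΔQ →
      α-injective (trans (line-seven _ _ (unique (α S) (∈Δ⇒∈α S∈ΔP) (∈Δ⇒∈α S∈ΔQ))) (sym αR≡k))
      where
      P∈αR : P ∈ line (α R)
      P∈αR = subst (λ k → P ∈ line k) (sym αR≡k) P∈k
      Q∈αR : Q ∈ line (α R)
      Q∈αR = subst (λ k → Q ∈ line k) (sym αR≡k) Q∈k

  module TriangleFano (T : Fin 7 → Block) (T-triangle : ∀ j → Triangle F (T j)) (T-seven : Seven T)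
                      (T-axiomA : AxiomA T) (T-axiomB : AxiomB T) where

    apex : Fin 7 → Point
    apex j = ApexForm.apex (triangle⇒apexForm (T-triangle j))

    base : Fin 7 → Fin 7
    base j = ApexForm.base (triangle⇒apexForm (T-triangle j))

    apex∉base : ∀ j → apex j ∉ line (base j)
    apex∉base j = ApexForm.apex∉base (triangle⇒apexForm (T-triangle j))

    T≡Δ : ∀ j → T j ≡ Δ[ apex j , line (base j) ]
    T≡Δ j = ApexForm.t≡Δ[apex,base] (triangle⇒apexForm (T-triangle j))

    ∈T⇒≢apex : P ∈ T j → P ≢ apex j
    ∈T⇒≢apex {j = j} = ∈Δ[]⇒≢ ∘ subst (_ ∈_) (T≡Δ j)

    ∈T⇒∉base : P ∈ T j → P ∉ line (base j)
    ∈T⇒∉base {j = j} = ∈Δ[]⇒∉ ∘ subst (_ ∈_) (T≡Δ j)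

    ∉T⇒∈base : P ∉ T j → P ≢ apex j → P ∈ line (base j)
    ∉T⇒∈base {j = j} P∉T = ∉Δ[]⇒∈ (P∉T ∘ subst (_ ∈_) (sym (T≡Δ j)))

    line-through-apex-meets-base : R ∈ T j → apex j ∈ line l → R ∈ line l → Q ∈ line l →
                                   Q ≢ apex j → Q ≢ R → Q ∈ line (base j)
    line-through-apex-meets-base {j = j} R∈j A∈l R∈l Q∈l Q≢A Q≢R =
      line-avoiding-two-contains-third A∈l R∈l Q∈l (≢-sym (∈T⇒≢apex R∈j)) (≢-sym Q≢A) (≢-sym Q≢R)
        (apex∉base j) (∈T⇒∉base R∈j)

    block-through-apex-meets-base : ∀ {u} → R ∈ T j → apex j ∈ T u → R ∈ T u → Q ∈ T u →
                                    Q ≢ apex j → Q ≢ R → Q ∈ line (base j)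
    block-through-apex-meets-base {R} {j} {Q} {u} R∈j A∈u R∈u Q∈u Q≢A Q≢R = ∉T⇒∈base Q∉j Q≢A
      where
      Tu≢Tj : T u ≢ T j
      Tu≢Tj Tu≡Tj = ∈T⇒≢apex (subst (apex j ∈_) Tu≡Tj A∈u) refl
      Q∉j : Q ∉ T j
      Q∉j Q∈j = Q≢R (AxiomB⇒meet-unique T-axiomB Tu≢Tj Q∈u Q∈j R∈u R∈j)

    -- If two blocks meeting in R had the same apex A, the third point W of the line AR
    -- and the third point Z of the block through A and R would both be the meet of
    -- the two bases; then that block would be the line AR.
    apex-injective : Injective _≡_ _≡_ apex
    apex-injective {j} {k} Aj≡Ak with j ≟ k
    ... | yes j≡k = j≡k
    ... | no  j≢k with T-axiomB j k (j≢k ∘ T-seven j k)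
    ...   | R , (R∈j , R∈k) , _
      with T-axiomA (apex j) R (≢-sym (∈T⇒≢apex R∈j))
         | ∣p∣≡3⇒∃-third (line-size (line-through (≢-sym (∈T⇒≢apex R∈j)))) (apex j) R
    ...   | u , (A∈u , R∈u) , _ | W , W∈AR , W≢A , W≢R
      with ∣p∣≡3⇒∃-third (proj₁ (T-triangle u)) (apex j) R
    ...   | Z , Z∈u , Z≢A , Z≢R =
      ⊥-elim (triangle-noncollinear (T-triangle u) A∈u R∈u Z∈u A≢R (≢-sym Z≢A) (≢-sym Z≢R)
                A∈AR R∈AR (subst (_∈ line AR) (sym Z≡W) W∈AR))
      where
      A≢R : apex j ≢ R
      A≢R = ≢-sym (∈T⇒≢apex R∈j)
      AR : Fin 7
      AR = line-through A≢R
      A∈AR : apex j ∈ line AR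
      A∈AR = ∈line-throughˡ A≢R
      R∈AR : R ∈ line AR
      R∈AR = ∈line-throughʳ A≢R
      bases-distinct : base j ≢ base k
      bases-distinct bj≡bk = j≢k (T-seven j k (begin
        T j                           ≡⟨ T≡Δ j ⟩
        Δ[ apex j , line (base j) ]   ≡⟨ cong₂ (λ A b → Δ[ A , line b ]) Aj≡Ak bj≡bk ⟩
        Δ[ apex k , line (base k) ]   ≡⟨ T≡Δ k ⟨
        T k                           ∎))
        where open ≡-Reasoning
      Z≡W : Z ≡ W
      Z≡W = lines-meet-unique bases-distinct
        (block-through-apex-meets-base R∈j A∈u R∈u Z∈u Z≢A Z≢R)
        (block-through-apex-meets-base R∈k (subst (_∈ T u) Aj≡Ak A∈u) R∈u Z∈u
          (subst (Z ≢_) Aj≡Ak Z≢A) Z≢R)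
        (line-through-apex-meets-base R∈j A∈AR R∈AR W∈AR W≢A W≢R)
        (line-through-apex-meets-base R∈k (subst (_∈ line AR) Aj≡Ak A∈AR) R∈AR W∈AR
          (subst (W ≢_) Aj≡Ak W≢A) W≢R)

    apex⁻¹ : Point → Fin 7
    apex⁻¹ P = proj₁ (injective⇒surjective apex-injective P)

    apex∘apex⁻¹ : ∀ P → apex (apex⁻¹ P) ≡ P
    apex∘apex⁻¹ P = proj₂ (injective⇒surjective apex-injective P)

    apex⁻¹∘apex : ∀ j → apex⁻¹ (apex j) ≡ j
    apex⁻¹∘apex j = apex-injective (apex∘apex⁻¹ (apex j))

    apex⁻¹-injective : Injective _≡_ _≡_ apex⁻¹
    apex⁻¹-injective {P} {Q} e = trans (sym (apex∘apex⁻¹ P)) (trans (cong apex e) (apex∘apex⁻¹ Q))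

    α : Point → Fin 7
    α P = base (apex⁻¹ P)

    T≡Δα : ∀ P → T (apex⁻¹ P) ≡ Δ F α P
    T≡Δα P = trans (T≡Δ (apex⁻¹ P)) (cong (λ A → Δ[ A , line (α P) ]) (apex∘apex⁻¹ P))

    α-irreflexive : ∀ P → P ∉ line (α P)
    α-irreflexive P = subst (_∉ line (α P)) (apex∘apex⁻¹ P) (apex∉base (apex⁻¹ P))

    α-exactly-one : ∀ P Q → P ≢ Q →
                    (P ∈ line (α Q) → Q ∉ line (α P)) × (Q ∉ line (α P) → P ∈ line (α Q))
    α-exactly-one P Q P≢Q with T-axiomB (apex⁻¹ P) (apex⁻¹ Q) (P≢Q ∘ apex⁻¹-injective ∘ T-seven _ _)
    ... | R , (R∈P , R∈Q) , single =
      single-meet⇒exactly-one-incidence P≢Q (α-irreflexive P) (α-irreflexive Q) (toΔ R∈P) (toΔ R∈Q)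
        λ S S∈ΔP S∈ΔQ → single S (fromΔ S∈ΔP) (fromΔ S∈ΔQ)
      where
      toΔ : ∀ {S X} → S ∈ T (apex⁻¹ X) → S ∈ Δ F α X
      toΔ {X = X} = subst (_ ∈_) (T≡Δα X)
      fromΔ : ∀ {S X} → S ∈ Δ F α X → S ∈ T (apex⁻¹ X)
      fromΔ {X = X} = subst (_ ∈_) (sym (T≡Δα X))

    α-oriented : Oriented F α
    α-oriented = α-irreflexive , α-exactly-one

    T≈Δα : SameSet F T (Δ F α)
    T≈Δα = (λ j → apex j , trans (cong T (sym (apex⁻¹∘apex j))) (T≡Δα (apex j)))
         , (λ P → apex⁻¹ P , sym (T≡Δα P))

    α-unique : ∀ β → Oriented F β → SameSet F T (Δ F β) → ∀ P → β P ≡ α P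
    α-unique β (β-irreflexive , _) (_ , Δβ⊆T) P with Δβ⊆T P
    ... | j , ΔβP≡Tj with Δ[]-injective (β-irreflexive P) (apex∉base j) (trans ΔβP≡Tj (T≡Δ j))
    ...   | P≡apex-j , βP≡base-j =
      trans βP≡base-j (cong base (sym (trans (cong apex⁻¹ P≡apex-j) (apex⁻¹∘apex j))))

proposition3p3 : (F : FanoPlane) →
    -- (i)
    ((α : Fin 7 → Fin 7) → Oriented F α →
      ((P : Fin 7) → Triangle F (Δ F α P)) × Seven (Δ F α) ×
      AxiomA (Δ F α) × AxiomB (Δ F α))
    ×
    -- (ii)
    ((T : Fin 7 → Block) → ((i : Fin 7) → Triangle F (T i)) → Seven T →
      AxiomA T → AxiomB T →
      Σ (Fin 7 → Fin 7) λ α → (Oriented F α × SameSet F T (Δ F α)) ×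
        ((β : Fin 7 → Fin 7) → Oriented F β → SameSet F T (Δ F β) →
          (P : Fin 7) → β P ≡ α P))
proposition3p3 F =
    (λ α oriented → let open OrientedMap α oriented in
      Δ-triangle , Δ-seven , Δ-axiomA , Δ-axiomB)
  , (λ T T-triangle T-seven T-axiomA T-axiomB →
      let open TriangleFano T T-triangle T-seven T-axiomA T-axiomB in
      α , (α-oriented , T≈Δα) , α-unique)
  where open FanoGeometry F
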